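{- For every $n\geq 4$, the wheel $W_n$ has an interval total $(n+3)$-coloring; consequently $W_\tau(W_n)\geq n+3$.
   Context: All graphs are finite, undirected, without loops or multiple edges. For $n\geq 4$ the wheel $W_n$ has vertex set $\{u,v_1,\ldots,v_{n-1}\}$ and edge set $\{uv_i:1\leq i\leq n-1\}\cup\{v_iv_{i+1}:1\leq i\leq n-2\}\cup\{v_1v_{n-1}\}$. A total coloring of a graph $G$ is an assignment of colors to the vertices and edges of $G$ such that no two adjacent vertices, no two adjacent edges, and no vertex and an edge incident to it receive the same color. For a positive integer $t$, an interval total $t$-coloring of $G$ is a total coloring of $G$ with colors $1,2,\ldots,t$ such that each color $i\in\{1,\ldots,t\}$ is used on at least one vertex or edge, and for each vertex $v$ the set consisting of the color of $v$ and the colors of the edges incident to $v$ consists of $d_G(v)+1$ consecutive integers, where $d_G(v)$ is the degree of $v$. For a graph $G$ having some interval total coloring, $W_\tau(G)$ is the greatest $t$ for which $G$ has an interval total $t$-coloring. -}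

module Defs where

open import Data.Nat using (ℕ; zero; suc; _+_; _∸_; _≤_; _≡ᵇ_; s≤s)
open import Data.Bool using (Bool; true; false; T; _∨_; _∧_)
open import Data.Fin using (Fin; zero; suc; toℕ)
open import Data.List using (List; length; filterᵇ; allFin)
open import Data.Product using (Σ; ∃; ∃-syntax; _×_; _,_)
open import Data.Sum using (_⊎_)
open import Relation.Binary.PropositionalEquality using (_≡_; _≢_; refl)
open import Relation.Nullary using (¬_)
open import Function.Bundles using (_⇔_)

record Graph : Set where
  field
    n     : ℕ
    adj   : Fin n → Fin n → Bool
    sym   : ∀ x y → adj x y ≡ adj y x
    irrefl : ∀ x → adj x x ≡ false

open Graph public

Adj : (G : Graph) → Fin (n G) → Fin (n G) → Set
Adj G x y = T (adj G x y)

degree : (G : Graph) → Fin (n G) → ℕ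
degree G v = length (filterᵇ (adj G v) (allFin (n G)))

-- Edge colours are given by a function on ordered pairs,
-- required to be symmetric on edges; its values on non-edges are ignored.
record TotalAssignment (G : Graph) : Set where
  field
    vcol : Fin (n G) → ℕ
    ecol : Fin (n G) → Fin (n G) → ℕ
    ecol-sym : ∀ x y → Adj G x y → ecol x y ≡ ecol y x

open TotalAssignment public

IsTotalColoring : (G : Graph) → TotalAssignment G → Set
IsTotalColoring G α =
    (∀ x y → Adj G x y → vcol α x ≢ vcol α y)
  × (∀ x y z → Adj G x y → Adj G x z → y ≢ z → ecol α x y ≢ ecol α x z)
  × (∀ x y → Adj G x y → vcol α x ≢ ecol α x y)

ColourUsed : (G : Graph) → TotalAssignment G → ℕ → Set
ColourUsed G α i =
  (∃[ x ] vcol α x ≡ i) ⊎ (∃[ x ] ∃[ y ] (Adj G x y × ecol α x y ≡ i))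

InSpectrum : (G : Graph) → TotalAssignment G → Fin (n G) → ℕ → Set
InSpectrum G α v k = vcol α v ≡ k ⊎ (∃[ w ] (Adj G v w × ecol α v w ≡ k))

IsIntervalTotalColoring : (G : Graph) → ℕ → TotalAssignment G → Set
IsIntervalTotalColoring G t α =
    IsTotalColoring G α
  × (∀ x → 1 ≤ vcol α x × vcol α x ≤ t)
  × (∀ x y → Adj G x y → 1 ≤ ecol α x y × ecol α x y ≤ t)
  × (∀ i → 1 ≤ i → i ≤ t → ColourUsed G α i)
  × (∀ v → ∃[ a ] (∀ k → (a ≤ k × k ≤ a + degree G v) ⇔ InSpectrum G α v k))

HasIntervalTotalColoring : (G : Graph) → ℕ → Set
HasIntervalTotalColoring G t = Σ (TotalAssignment G) (IsIntervalTotalColoring G t)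

-- Wheel W_n (n ≥ 4) on vertex set Fin n: vertex zero is the hub u and
-- vertex suc i (i : Fin (n-1)) is the rim vertex v_{toℕ i + 1}.
-- Rim vertices with indices x, y ∈ {0,…,m-1} (m = n-1) are adjacent iff
-- y = x+1, x = y+1, or {x,y} = {0, m-1}  (i.e. v_i v_{i+1} and v_1 v_{n-1}).
rimAdjℕ : ℕ → ℕ → ℕ → Bool
rimAdjℕ m x y =
     (y ≡ᵇ suc x)
  ∨ ((x ≡ᵇ suc y)
  ∨ (((x ≡ᵇ 0) ∧ (y ≡ᵇ (m ∸ 1)))
  ∨ ((y ≡ᵇ 0) ∧ (x ≡ᵇ (m ∸ 1)))))

wheelAdj : (m : ℕ) → Fin (suc m) → Fin (suc m) → Bool
wheelAdj m zero zero = false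
wheelAdj m zero (suc j) = true
wheelAdj m (suc i) zero = true
wheelAdj m (suc i) (suc j) = rimAdjℕ m (toℕ i) (toℕ j)

private
  swap4 : ∀ p q r s → (p ∨ (q ∨ (r ∨ s))) ≡ (q ∨ (p ∨ (s ∨ r)))
  swap4 false false false false = refl
  swap4 false false false true = refl
  swap4 false false true false = refl
  swap4 false false true true = refl
  swap4 false true r s = refl
  swap4 true false r s = refl
  swap4 true true r s = refl

  wheelAdj-sym : ∀ m x y → wheelAdj m x y ≡ wheelAdj m y x
  wheelAdj-sym m zero zero = refl
  wheelAdj-sym m zero (suc j) = refl
  wheelAdj-sym m (suc i) zero = refl
  wheelAdj-sym m (suc i) (suc j) =
    swap4 (toℕ j ≡ᵇ suc (toℕ i)) (toℕ i ≡ᵇ suc (toℕ j))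
          ((toℕ i ≡ᵇ 0) ∧ (toℕ j ≡ᵇ (m ∸ 1))) ((toℕ j ≡ᵇ 0) ∧ (toℕ i ≡ᵇ (m ∸ 1)))

  n≢ᵇsn : ∀ a → (a ≡ᵇ suc a) ≡ false
  n≢ᵇsn zero = refl
  n≢ᵇsn (suc a) = n≢ᵇsn a

  rim-irr : ∀ k x → rimAdjℕ (suc (suc (suc k))) x x ≡ false
  rim-irr k zero = refl
  rim-irr k (suc x) rewrite n≢ᵇsn x = refl

  wheelAdj-irr : ∀ k x → wheelAdj (suc (suc (suc k))) x x ≡ false
  wheelAdj-irr k zero = refl
  wheelAdj-irr k (suc i) = rim-irr k (toℕ i)

Wheel : (n : ℕ) → 4 ≤ n → Graph
Wheel (suc (suc (suc (suc k)))) (s≤s (s≤s (s≤s (s≤s _)))) = record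
  { n = suc (suc (suc (suc k)))
  ; adj = wheelAdj (suc (suc (suc k)))
  ; sym = wheelAdj-sym (suc (suc (suc k)))
  ; irrefl = wheelAdj-irr k
  }

module Submission where

-- Let m = n - 1 be the number of rim vertices; position x < m stands for the rim vertex v_{x+1}.
-- The hub gets colour 1 and the spokes get 2, …, m + 1, laid out around the rim as
-- 2, 4, 6, … up to the top colour m + 1 and back down …, 5, 3.  The spoke colours of rim
-- neighbours then differ by 2, or by 1 at the two turning points, which leaves room to colour
-- each rim vertex and its two rim edges so that a rim vertex whose spoke has colour a sees
-- exactly a, a + 1, a + 2, a + 3.  The hub sees 1, …, m + 1, and the rim vertex whose spoke has
-- the top colour m + 1 supplies the remaining colours m + 2, m + 3, m + 4 = n + 3.

open import Data.Bool using (Bool; true; false; T; _∨_; _∧_; if_then_else_)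
open import Data.Bool.Properties using (∨-comm; T-∨; T-∧)
open import Data.Empty using (⊥-elim)
open import Data.Fin using (Fin; zero; suc; toℕ; fromℕ<)
open import Data.Fin.Properties using (toℕ<n; toℕ-fromℕ<; toℕ-injective)
open import Data.List using (length; filterᵇ; tabulate)
open import Data.Nat
open import Data.Nat.Properties
open import Data.Product using (∃-syntax; _×_; _,_; proj₁; proj₂)
open import Data.Sum using (_⊎_; inj₁; inj₂)
open import Data.Unit using (tt)
open import Function using (_∘_; id)
open import Function.Bundles using (Equivalence; _⇔_; mk⇔)
open import Relation.Nullary using (¬_; yes; no)
open import Relation.Binary using (tri<; tri≈; tri>)
open import Relation.Binary.PropositionalEquality hiding (J)
open import Defs hiding (sym)

if-T : ∀ {A : Set} {b} {x y : A} → T b → (if b then x else y) ≡ x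
if-T {b = true} _ = refl

if-¬T : ∀ {A : Set} {b} {x y : A} → ¬ T b → (if b then x else y) ≡ y
if-¬T {b = false} _  = refl
if-¬T {b = true}  ¬t = ⊥-elim (¬t tt)

≤⇒¬<ᵇ : ∀ {m n} → n ≤ m → ¬ T (m <ᵇ n)
≤⇒¬<ᵇ {m} {n} n≤m t = <⇒≱ (<ᵇ⇒< m n t) n≤m

≢⇒¬≡ᵇ : ∀ {m n} → m ≢ n → ¬ T (m ≡ᵇ n)
≢⇒¬≡ᵇ {m} {n} m≢n t = m≢n (≡ᵇ⇒≡ m n t)

T-∨ˡ : ∀ {a} b → T a → T (a ∨ b)
T-∨ˡ b = Equivalence.from T-∨ ∘ inj₁

T-∨ʳ : ∀ a {b} → T b → T (a ∨ b)
T-∨ʳ a = Equivalence.from T-∨ ∘ inj₂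

T-≡ᵇ-refl : ∀ n → T (n ≡ᵇ n)
T-≡ᵇ-refl n = ≡⇒≡ᵇ n n refl

m≡n+o⇒m∸n≡o : ∀ {m n o} → m ≡ n + o → m ∸ n ≡ o
m≡n+o⇒m∸n≡o {n = n} {o} refl = m+n∸m≡n n o

2*[1+n]≡2+2*n : ∀ n → 2 * suc n ≡ 2 + 2 * n
2*[1+n]≡2+2*n n = *-suc 2 n

2*n≡n+n : ∀ n → 2 * n ≡ n + n
2*n≡n+n n = cong (n +_) (+-identityʳ n)

m≡n+o⇒o≤n⇒m≤2*n : ∀ {m n o} → m ≡ n + o → o ≤ n → m ≤ 2 * n
m≡n+o⇒o≤n⇒m≤2*n {n = n} {o} refl o≤n = subst (n + o ≤_) (sym (2*n≡n+n n)) (+-monoʳ-≤ n o≤n)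

1+2*n≡n+[1+n] : ∀ n → 1 + 2 * n ≡ n + suc n
1+2*n≡n+[1+n] n = sym (trans (+-suc n n) (cong suc (sym (2*n≡n+n n))))

even-or-odd : ∀ n → ∃[ h ] (n ≡ 2 * h ⊎ n ≡ 1 + 2 * h)
even-or-odd zero = 0 , inj₁ refl
even-or-odd (suc n) with even-or-odd n
... | h , inj₁ refl = h , inj₂ refl
... | h , inj₂ refl = suc h , inj₁ (sym (2*[1+n]≡2+2*n h))

count : ℕ → (ℕ → Bool) → ℕ
count zero    p = 0
count (suc n) p = (if p 0 then 1 else 0) + count n (p ∘ suc)

length-filterᵇ-tabulate : ∀ {A : Set} n (f : Fin n → A) (q : A → Bool) (p : ℕ → Bool) →
  (∀ j → q (f j) ≡ p (toℕ j)) → length (filterᵇ q (tabulate f)) ≡ count n p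
length-filterᵇ-tabulate zero    f q p q≗p = refl
length-filterᵇ-tabulate (suc n) f q p q≗p with q (f zero) | p 0 | q≗p zero
... | true  | true  | _ = cong suc (length-filterᵇ-tabulate n (f ∘ suc) q (p ∘ suc) (q≗p ∘ suc))
... | false | false | _ = length-filterᵇ-tabulate n (f ∘ suc) q (p ∘ suc) (q≗p ∘ suc)

count-true : ∀ n → count n (λ _ → true) ≡ n
count-true zero    = refl
count-true (suc n) = cong suc (count-true n)

count-false : ∀ n → count n (λ _ → false) ≡ 0
count-false zero    = refl
count-false (suc n) = count-false n

count-cong : ∀ n {p q} → (∀ y → y < n → p y ≡ q y) → count n p ≡ count n q
count-cong zero    p≗q = refl
count-cong (suc n) p≗q =
  cong₂ _+_ (cong (λ b → if b then 1 else 0) (p≗q 0 z<s)) (count-cong n (λ y → p≗q (suc y) ∘ s<s))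

count-point : ∀ {n a} → a < n → count n (λ y → y ≡ᵇ a) ≡ 1
count-point {suc n} {zero}  _   = cong suc (count-false n)
count-point {suc n} {suc a} a<n = count-point (≤-pred a<n)

count-∨ : ∀ n p q → (∀ y → T (p y) → ¬ T (q y)) →
  count n (λ y → p y ∨ q y) ≡ count n p + count n q
count-∨ zero    p q disjoint = refl
count-∨ (suc n) p q disjoint with p 0 | q 0 | disjoint 0 | count-∨ n (p ∘ suc) (q ∘ suc) (disjoint ∘ suc)
... | true  | true  | d | _  = ⊥-elim (d tt tt)
... | true  | false | _ | ih = cong suc ih
... | false | true  | _ | ih = trans (cong suc ih) (sym (+-suc _ _))
... | false | false | _ | ih = ih

T⇔⇒≡ : ∀ {a b} → (T a → T b) → (T b → T a) → a ≡ b
T⇔⇒≡ {true}  {true}  _ _ = refl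
T⇔⇒≡ {true}  {false} f _ = ⊥-elim (f tt)
T⇔⇒≡ {false} {true}  _ g = ⊥-elim (g tt)
T⇔⇒≡ {false} {false} _ _ = refl

count-pair : ∀ {n a b} p → a < n → b < n → a ≢ b →
  (∀ y → y < n → T (p y) ⇔ (y ≡ a ⊎ y ≡ b)) → count n p ≡ 2
count-pair {n} {a} {b} p a<n b<n a≢b p⇔ = begin
  count n p                                       ≡⟨ count-cong n (λ y y<n → T⇔⇒≡ (to y y<n) (from y y<n)) ⟩
  count n (λ y → (y ≡ᵇ a) ∨ (y ≡ᵇ b))             ≡⟨ count-∨ n _ _ disjoint ⟩
  count n (λ y → y ≡ᵇ a) + count n (λ y → y ≡ᵇ b) ≡⟨ cong₂ _+_ (count-point a<n) (count-point b<n) ⟩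
  2                                               ∎
  where
  open ≡-Reasoning
  disjoint : ∀ y → T (y ≡ᵇ a) → ¬ T (y ≡ᵇ b)
  disjoint y ya yb = a≢b (trans (sym (≡ᵇ⇒≡ y a ya)) (≡ᵇ⇒≡ y b yb))
  to : ∀ y → y < n → T (p y) → T ((y ≡ᵇ a) ∨ (y ≡ᵇ b))
  to y y<n t with Equivalence.to (p⇔ y y<n) t
  ... | inj₁ y≡a = T-∨ˡ (y ≡ᵇ b) (≡⇒≡ᵇ y a y≡a)
  ... | inj₂ y≡b = T-∨ʳ (y ≡ᵇ a) (≡⇒≡ᵇ y b y≡b)
  from : ∀ y → y < n → T ((y ≡ᵇ a) ∨ (y ≡ᵇ b)) → T (p y)
  from y y<n t with Equivalence.to T-∨ t
  ... | inj₁ ya = Equivalence.from (p⇔ y y<n) (inj₁ (≡ᵇ⇒≡ y a ya))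
  ... | inj₂ yb = Equivalence.from (p⇔ y y<n) (inj₂ (≡ᵇ⇒≡ y b yb))

next : ℕ → ℕ → ℕ
next m x = if suc x ≡ᵇ m then 0 else suc x

prev : ℕ → ℕ → ℕ
prev m zero    = m ∸ 1
prev m (suc x) = x

next-last : ∀ {m x} → suc x ≡ m → next m x ≡ 0
next-last {m} {x} e = if-T (≡⇒≡ᵇ (suc x) m e)

next-inner : ∀ {m x} → suc x < m → next m x ≡ suc x
next-inner lt = if-¬T (≢⇒¬≡ᵇ (<⇒≢ lt))

next<m : ∀ {m x} → x < m → next m x < m
next<m {m} {x} x<m with suc x ≟ m
... | yes e = subst (_< m) (sym (next-last {m} {x} e)) (≤-trans (s≤s z≤n) x<m)
... | no ne = subst (_< m) (sym (next-inner {m} {x} lt)) lt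
  where lt = ≤∧≢⇒< x<m ne

prev<m : ∀ {m x} → x < m → prev m x < m
prev<m {suc m} {zero} _ = n<1+n m
prev<m {x = suc x} x<m = <-trans (n<1+n x) x<m

next≢prev : ∀ {m x} → 3 ≤ m → x < m → next m x ≢ prev m x
next≢prev {x = zero}        (s≤s (s≤s (s≤s _))) _ = λ ()
next≢prev {x = suc zero}    (s≤s (s≤s (s≤s _))) _ = λ ()
next≢prev {m} {suc (suc x)} _ x<m with suc (suc (suc x)) ≟ m
... | yes e = λ e′ → 0≢1+n (trans (sym (next-last {m} e)) e′)
... | no ne = λ e′ →
  1+n≰n (≤-trans (n≤1+n _) (≤-reflexive (trans (sym (next-inner {m} (≤∧≢⇒< x<m ne))) e′)))

wraps : ℕ → ℕ → ℕ → Bool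
wraps m x y = ((x ≡ᵇ 0) ∧ (y ≡ᵇ m ∸ 1)) ∨ ((y ≡ᵇ 0) ∧ (x ≡ᵇ m ∸ 1))

-- The rim edge {x, y} is {z, next m z} for z = edgeStart m x y.
edgeStart : ℕ → ℕ → ℕ → ℕ
edgeStart m x y = if wraps m x y then m ∸ 1 else x ⊓ y

edgeStart-comm : ∀ m x y → edgeStart m x y ≡ edgeStart m y x
edgeStart-comm m x y =
  cong₂ (λ b z → if b then m ∸ 1 else z) (∨-comm ((x ≡ᵇ 0) ∧ (y ≡ᵇ m ∸ 1)) _) (⊓-comm x y)

wraps-last : ∀ x → T (wraps (suc x) x 0)
wraps-last x = T-∨ʳ ((x ≡ᵇ 0) ∧ (0 ≡ᵇ x)) (T-≡ᵇ-refl x)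

wraps-first : ∀ m → T (wraps m 0 (m ∸ 1))
wraps-first m = T-∨ˡ ((m ∸ 1 ≡ᵇ 0) ∧ (0 ≡ᵇ m ∸ 1)) (T-≡ᵇ-refl (m ∸ 1))

¬wraps-suc : ∀ {m} x → 3 ≤ m → ¬ T (wraps m x (suc x))
¬wraps-suc zero    (s≤s (s≤s (s≤s _))) ()
¬wraps-suc (suc x) _                   ()

¬wraps-pred : ∀ {m} x → 3 ≤ m → ¬ T (wraps m (suc x) x)
¬wraps-pred zero    (s≤s (s≤s (s≤s _))) ()
¬wraps-pred (suc x) _                   ()

edgeStart-next : ∀ {m x} → 3 ≤ m → x < m → edgeStart m x (next m x) ≡ x
edgeStart-next {m} {x} 3≤m x<m with suc x ≟ m
... | yes refl rewrite next-last {suc x} {x} refl = if-T (wraps-last x)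
... | no ne rewrite next-inner {m} {x} (≤∧≢⇒< x<m ne) =
  trans (if-¬T (¬wraps-suc x 3≤m)) (m≤n⇒m⊓n≡m (n≤1+n x))

edgeStart-prev : ∀ {m x} → 3 ≤ m → edgeStart m x (prev m x) ≡ prev m x
edgeStart-prev {m} {zero}  _   = if-T (wraps-first m)
edgeStart-prev {m} {suc x} 3≤m = trans (if-¬T (¬wraps-pred x 3≤m)) (m≥n⇒m⊓n≡n (n≤1+n x))

rimAdjℕ-next : ∀ {m x} → x < m → T (rimAdjℕ m x (next m x))
rimAdjℕ-next {m} {x} x<m with suc x ≟ m
... | yes refl rewrite next-last {suc x} {x} refl =
  T-∨ʳ (x ≡ᵇ 1) (T-∨ʳ ((x ≡ᵇ 0) ∧ (0 ≡ᵇ x)) (T-≡ᵇ-refl x))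
... | no ne rewrite next-inner {m} {x} (≤∧≢⇒< x<m ne) = T-∨ˡ _ (T-≡ᵇ-refl x)

rimAdjℕ-prev : ∀ {m} x → T (rimAdjℕ m x (prev m x))
rimAdjℕ-prev {m} zero =
  T-∨ʳ (m ∸ 1 ≡ᵇ 1) (T-∨ˡ ((m ∸ 1 ≡ᵇ 0) ∧ (0 ≡ᵇ m ∸ 1)) (T-≡ᵇ-refl (m ∸ 1)))
rimAdjℕ-prev (suc x) = T-∨ʳ (x ≡ᵇ suc (suc x)) (T-∨ˡ _ (T-≡ᵇ-refl x))

rimAdjℕ-cases : ∀ {m x y} → T (rimAdjℕ m x y) →
  y ≡ suc x ⊎ x ≡ suc y ⊎ (x ≡ 0 × y ≡ m ∸ 1) ⊎ (y ≡ 0 × x ≡ m ∸ 1)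
rimAdjℕ-cases {m} {x} {y} t with Equivalence.to T-∨ t
... | inj₁ t₁ = inj₁ (≡ᵇ⇒≡ y (suc x) t₁)
... | inj₂ t₂ with Equivalence.to T-∨ t₂
...   | inj₁ t₃ = inj₂ (inj₁ (≡ᵇ⇒≡ x (suc y) t₃))
...   | inj₂ t₄ with Equivalence.to T-∨ t₄
...     | inj₁ t₅ = let (t₆ , t₇) = Equivalence.to T-∧ t₅ in
                    inj₂ (inj₂ (inj₁ (≡ᵇ⇒≡ x 0 t₆ , ≡ᵇ⇒≡ y (m ∸ 1) t₇)))
...     | inj₂ t₅ = let (t₆ , t₇) = Equivalence.to T-∧ t₅ in
                    inj₂ (inj₂ (inj₂ (≡ᵇ⇒≡ y 0 t₆ , ≡ᵇ⇒≡ x (m ∸ 1) t₇)))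

rimAdjℕ⇒ : ∀ {m x y} → y < m → T (rimAdjℕ m x y) → y ≡ next m x ⊎ y ≡ prev m x
rimAdjℕ⇒ {suc m} {x} {y} y<m t with rimAdjℕ-cases {suc m} {x} {y} t
... | inj₁ refl                        = inj₁ (sym (next-inner y<m))
... | inj₂ (inj₁ refl)                 = inj₂ refl
... | inj₂ (inj₂ (inj₁ (refl , refl))) = inj₂ refl
... | inj₂ (inj₂ (inj₂ (refl , refl))) = inj₁ (sym (next-last refl))

-- spokeColour m x, rimVertexColour m x and rimEdgeColour m x colour the spoke, the rim vertex
-- and the rim edge to next m x at position x of a wheel with m rim vertices.
spokeColour : ℕ → ℕ → ℕ
spokeColour m x = if 2 * x <ᵇ m then 2 + 2 * x else 1 + 2 * (m ∸ x)

rimEdgeColour : ℕ → ℕ → ℕ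
rimEdgeColour m x = if 1 + 2 * x <ᵇ m then 5 + 2 * x else 2 + 2 * (m ∸ x)

rimVertexColour : ℕ → ℕ → ℕ
rimVertexColour m zero    = 3
rimVertexColour m (suc x) = (if spokeColour m (suc x) ≡ᵇ suc m then 3 else 2) + spokeColour m (suc x)

spokeColour-rising : ∀ {m x} → 2 * x < m → spokeColour m x ≡ 2 + 2 * x
spokeColour-rising = if-T ∘ <⇒<ᵇ

spokeColour-falling : ∀ {m x J} → m ≡ x + J → m ≤ 2 * x → spokeColour m x ≡ 1 + 2 * J
spokeColour-falling {m} {x} {J} e m≤2x =
  trans (if-¬T (≤⇒¬<ᵇ m≤2x)) (cong (λ j → 1 + 2 * j) (m≡n+o⇒m∸n≡o {m} {x} {J} e))

rimEdgeColour-rising : ∀ {m x} → 1 + 2 * x < m → rimEdgeColour m x ≡ 5 + 2 * x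
rimEdgeColour-rising = if-T ∘ <⇒<ᵇ

rimEdgeColour-falling : ∀ {m x J} → m ≡ x + J → m ≤ 1 + 2 * x → rimEdgeColour m x ≡ 2 + 2 * J
rimEdgeColour-falling {m} {x} {J} e m≤1+2x =
  trans (if-¬T (≤⇒¬<ᵇ m≤1+2x)) (cong (λ j → 2 + 2 * j) (m≡n+o⇒m∸n≡o {m} {x} {J} e))

rimEdgeColour-wrap : ∀ m → rimEdgeColour (suc m) m ≡ 4
rimEdgeColour-wrap m = rimEdgeColour-falling {suc m} {m} {1} (+-comm 1 m) (s≤s (m≤m+n m (m + 0)))

rimVertexColour-top : ∀ {m x a} → spokeColour m (suc x) ≡ a → a ≡ suc m →
  rimVertexColour m (suc x) ≡ 3 + a
rimVertexColour-top {m} {x} refl top = cong (_+ spokeColour m (suc x)) (if-T (≡⇒≡ᵇ _ (suc m) top))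

rimVertexColour-below : ∀ {m x a} → spokeColour m (suc x) ≡ a → a ≢ suc m →
  rimVertexColour m (suc x) ≡ 2 + a
rimVertexColour-below {m} {x} refl below = cong (_+ spokeColour m (suc x)) (if-¬T (≢⇒¬≡ᵇ below))

data SpokeView (m x : ℕ) : Set where
  rising  : 2 * x < m → spokeColour m x ≡ 2 + 2 * x → SpokeView m x
  falling : ∀ J → m ≡ x + J → 1 ≤ J → J ≤ x → spokeColour m x ≡ 1 + 2 * J → SpokeView m x

spokeView : ∀ {m x} → x < m → SpokeView m x
spokeView {m} {x} x<m with 2 * x <? m
... | yes 2x<m = rising 2x<m (spokeColour-rising {m} {x} 2x<m)
... | no 2x≮m  = falling J m≡x+J (m<n⇒0<n∸m x<m) J≤x
                   (spokeColour-falling {m} {x} {J} m≡x+J (m≡n+o⇒o≤n⇒m≤2*n {m} {x} {J} m≡x+J J≤x))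
  where
  J = m ∸ x
  m≡x+J : m ≡ x + J
  m≡x+J = sym (m+[n∸m]≡n (<⇒≤ x<m))
  J≤x : J ≤ x
  J≤x = +-cancelˡ-≤ x J x (subst₂ _≤_ m≡x+J (2*n≡n+n x) (≮⇒≥ 2x≮m))

spokeColour-bounds : ∀ {m x} → x < m → 2 ≤ spokeColour m x × spokeColour m x ≤ suc m
spokeColour-bounds {m} {x} x<m with spokeView x<m
... | rising 2x<m s≡ = subst (λ c → 2 ≤ c × c ≤ suc m) (sym s≡) (s≤s (s≤s z≤n) , s≤s 2x<m)
... | falling J m≡x+J 1≤J J≤x s≡ = subst (λ c → 2 ≤ c × c ≤ suc m) (sym s≡)
  ( s≤s (≤-trans 1≤J (m≤m+n J _))
  , s≤s (subst₂ _≤_ (sym (2*n≡n+n J)) (sym m≡x+J) (+-monoˡ-≤ J J≤x)))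

spokeColour-injective : ∀ {m x y} → x < m → y < m → spokeColour m x ≡ spokeColour m y → x ≡ y
spokeColour-injective {m} {x} {y} x<m y<m eq with spokeView x<m | spokeView y<m
... | rising _ sx | rising _ sy =
  *-cancelˡ-≡ x y 2 (suc-injective (suc-injective (trans (sym sx) (trans eq sy))))
... | rising _ sx | falling J _ _ _ sy =
  ⊥-elim (even≢odd (suc x) J (trans (2*[1+n]≡2+2*n x) (trans (sym sx) (trans eq sy))))
... | falling J _ _ _ sx | rising _ sy =
  ⊥-elim (even≢odd (suc y) J (trans (2*[1+n]≡2+2*n y) (trans (sym sy) (trans (sym eq) sx))))
... | falling J m≡x+J _ _ sx | falling K m≡y+K _ _ sy =
  +-cancelʳ-≡ J x y (trans (sym m≡x+J) (trans m≡y+K (cong (y +_) (sym J≡K))))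
  where
  J≡K : J ≡ K
  J≡K = *-cancelˡ-≡ J K 2 (suc-injective (trans (sym sx) (trans eq sy)))

spokeColour-surjective : ∀ {m c} → 2 ≤ c → c ≤ suc m → ∃[ x ] (x < m × spokeColour m x ≡ c)
spokeColour-surjective {m} {c} 2≤c c≤1+m with even-or-odd c
... | zero , inj₁ refl = ⊥-elim (1+n≰n (≤-trans 2≤c z≤n))
... | suc h , inj₁ refl =
  h , ≤-<-trans (m≤m+n h (h + 0)) 2h<m , trans (spokeColour-rising {m} {h} 2h<m) (sym (2*[1+n]≡2+2*n h))
  where
  2h<m : 2 * h < m
  2h<m = ≤-pred (subst (_≤ suc m) (2*[1+n]≡2+2*n h) c≤1+m)
... | zero , inj₂ refl = ⊥-elim (1+n≰n (≤-pred 2≤c))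
... | suc J′ , inj₂ refl =
  x , x<m , spokeColour-falling {m} {x} {J} m≡x+J (m≡n+o⇒o≤n⇒m≤2*n {m} {x} {J} m≡x+J J≤x)
  where
  J = suc J′
  2J≤m : J + J ≤ m
  2J≤m = subst (_≤ m) (2*n≡n+n J) (≤-pred c≤1+m)
  x = m ∸ J
  m≡x+J : m ≡ x + J
  m≡x+J = sym (m∸n+n≡m (≤-trans (m≤m+n J J) 2J≤m))
  x<m : x < m
  x<m = subst (x <_) (sym m≡x+J) (subst (_≤ x + J) (+-comm x 1) (+-monoʳ-≤ x (s≤s z≤n)))
  J≤x : J ≤ x
  J≤x = +-cancelʳ-≤ J J x (subst (J + J ≤_) m≡x+J 2J≤m)

data RimVertexView (m x : ℕ) : Set where
  top   : spokeColour m (suc x) ≡ suc m → rimVertexColour m (suc x) ≡ 3 + suc m → RimVertexView m x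
  below : spokeColour m (suc x) ≤ m → rimVertexColour m (suc x) ≡ 2 + spokeColour m (suc x) →
          RimVertexView m x

rimVertexView : ∀ {m x} → suc x < m → RimVertexView m x
rimVertexView {m} {x} x<m with spokeColour m (suc x) ≟ suc m
... | yes s≡1+m = top s≡1+m (rimVertexColour-top {m} {x} s≡1+m refl)
... | no  s≢1+m =
  below (≤-pred (≤∧≢⇒< (proj₂ (spokeColour-bounds x<m)) s≢1+m)) (rimVertexColour-below {m} {x} refl s≢1+m)

top≢below : ∀ {m s} → s ≤ m → 3 + suc m ≢ 2 + s
top≢below {m} s≤m e =
  1+n≰n (≤-trans (n≤1+n (suc m)) (subst (_≤ m) (sym (suc-injective (suc-injective e))) s≤m))

rimVertexColour-injective : ∀ {m x y} → x < m → y < m →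
  rimVertexColour m x ≡ rimVertexColour m y → x ≡ y
rimVertexColour-injective {x = zero} {zero} _ _ _ = refl
rimVertexColour-injective {m} {x = zero} {suc y} _ y<m eq with rimVertexView y<m
... | top _ v = ⊥-elim (m≢1+m+n 3 (trans eq v))
... | below _ v =
  ⊥-elim (1+n≰n (≤-trans (proj₁ (spokeColour-bounds y<m)) (≤-pred (≤-pred (≤-reflexive (sym (trans eq v)))))))
rimVertexColour-injective {m} {x = suc x} {zero} x<m _ eq =
  sym (rimVertexColour-injective {m} {0} {suc x} (≤-trans (s≤s z≤n) x<m) x<m (sym eq))
rimVertexColour-injective {m} {x = suc x} {suc y} x<m y<m eq with rimVertexView x<m | rimVertexView y<m
... | top sx _ | top sy _ = spokeColour-injective x<m y<m (trans sx (sym sy))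
... | top _ vx | below sy≤m vy = ⊥-elim (top≢below sy≤m (trans (sym vx) (trans eq vy)))
... | below sx≤m vx | top _ vy = ⊥-elim (top≢below sx≤m (trans (sym vy) (trans (sym eq) vx)))
... | below _ vx | below _ vy =
  spokeColour-injective x<m y<m (suc-injective (suc-injective (trans (sym vx) (trans eq vy))))

data Arrangement : ℕ → ℕ → ℕ → Set where
  ⟨132⟩ : Arrangement 1 3 2
  ⟨213⟩ : Arrangement 2 1 3
  ⟨231⟩ : Arrangement 2 3 1
  ⟨312⟩ : Arrangement 3 1 2
  ⟨321⟩ : Arrangement 3 2 1

arrangement-≤3 : ∀ {p q r} → Arrangement p q r → p ≤ 3 × q ≤ 3 × r ≤ 3
arrangement-≤3 ⟨132⟩ = ≤ᵇ⇒≤ 1 3 _ , ≤ᵇ⇒≤ 3 3 _ , ≤ᵇ⇒≤ 2 3 _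
arrangement-≤3 ⟨213⟩ = ≤ᵇ⇒≤ 2 3 _ , ≤ᵇ⇒≤ 1 3 _ , ≤ᵇ⇒≤ 3 3 _
arrangement-≤3 ⟨231⟩ = ≤ᵇ⇒≤ 2 3 _ , ≤ᵇ⇒≤ 3 3 _ , ≤ᵇ⇒≤ 1 3 _
arrangement-≤3 ⟨312⟩ = ≤ᵇ⇒≤ 3 3 _ , ≤ᵇ⇒≤ 1 3 _ , ≤ᵇ⇒≤ 2 3 _
arrangement-≤3 ⟨321⟩ = ≤ᵇ⇒≤ 3 3 _ , ≤ᵇ⇒≤ 2 3 _ , ≤ᵇ⇒≤ 1 3 _

arrangement-≢0 : ∀ {p q r} → Arrangement p q r → p ≢ 0 × q ≢ 0 × r ≢ 0
arrangement-≢0 ⟨132⟩ = (λ ()) , (λ ()) , (λ ())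
arrangement-≢0 ⟨213⟩ = (λ ()) , (λ ()) , (λ ())
arrangement-≢0 ⟨231⟩ = (λ ()) , (λ ()) , (λ ())
arrangement-≢0 ⟨312⟩ = (λ ()) , (λ ()) , (λ ())
arrangement-≢0 ⟨321⟩ = (λ ()) , (λ ()) , (λ ())

arrangement-≢ : ∀ {p q r} → Arrangement p q r → p ≢ q × p ≢ r × q ≢ r
arrangement-≢ ⟨132⟩ = (λ ()) , (λ ()) , (λ ())
arrangement-≢ ⟨213⟩ = (λ ()) , (λ ()) , (λ ())
arrangement-≢ ⟨231⟩ = (λ ()) , (λ ()) , (λ ())
arrangement-≢ ⟨312⟩ = (λ ()) , (λ ()) , (λ ())
arrangement-≢ ⟨321⟩ = (λ ()) , (λ ()) , (λ ())

arrangement-covers : ∀ {p q r} → Arrangement p q r →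
  ∀ d → 1 ≤ d → d ≤ 3 → d ≡ p ⊎ d ≡ q ⊎ d ≡ r
arrangement-covers ⟨132⟩ 1 _ _ = inj₁ refl
arrangement-covers ⟨132⟩ 2 _ _ = inj₂ (inj₂ refl)
arrangement-covers ⟨132⟩ 3 _ _ = inj₂ (inj₁ refl)
arrangement-covers ⟨213⟩ 1 _ _ = inj₂ (inj₁ refl)
arrangement-covers ⟨213⟩ 2 _ _ = inj₁ refl
arrangement-covers ⟨213⟩ 3 _ _ = inj₂ (inj₂ refl)
arrangement-covers ⟨231⟩ 1 _ _ = inj₂ (inj₂ refl)
arrangement-covers ⟨231⟩ 2 _ _ = inj₁ refl
arrangement-covers ⟨231⟩ 3 _ _ = inj₂ (inj₁ refl)
arrangement-covers ⟨312⟩ 1 _ _ = inj₂ (inj₁ refl)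
arrangement-covers ⟨312⟩ 2 _ _ = inj₂ (inj₂ refl)
arrangement-covers ⟨312⟩ 3 _ _ = inj₁ refl
arrangement-covers ⟨321⟩ 1 _ _ = inj₂ (inj₂ refl)
arrangement-covers ⟨321⟩ 2 _ _ = inj₂ (inj₁ refl)
arrangement-covers ⟨321⟩ 3 _ _ = inj₁ refl
arrangement-covers _ 0 () _
arrangement-covers _ (suc (suc (suc (suc _)))) _ (s≤s (s≤s (s≤s ())))

record RimSpectrum (m x : ℕ) : Set where
  field
    base : ℕ
    {p q r} : ℕ
    arrangement : Arrangement p q r
    spoke≡  : spokeColour m x ≡ base
    vertex≡ : rimVertexColour m x ≡ p + base
    next≡   : rimEdgeColour m x ≡ q + base
    prev≡   : rimEdgeColour m (prev m x) ≡ r + base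

-- peakOdd and peakEven are the position whose spoke has the top colour m + 1, for odd and even m.
data Position : ℕ → ℕ → Set where
  first    : ∀ {m} → 2 ≤ m → Position m 0
  rising   : ∀ {m} x → 1 + 2 * suc x < m → Position m (suc x)
  peakOdd  : ∀ x → Position (1 + 2 * suc x) (suc x)
  peakEven : ∀ x → Position (2 * suc x) (suc x)
  falling  : ∀ x J → J ≤ x → Position (suc x + J) (suc x)

position : ∀ {m x} → 2 ≤ m → x < m → Position m x
position {x = zero} 2≤m _ = first 2≤m
position {m} {suc x} _ x<m with <-cmp (1 + 2 * suc x) m
... | tri< lt _ _ = rising x lt
... | tri≈ _ refl _ = peakOdd x
... | tri> _ _ gt with m≤n⇒m<n∨m≡n (≤-pred gt)
...   | inj₂ refl = peakEven x
...   | inj₁ m<2y = subst (λ m → Position m (suc x)) (sym m≡y+J) (falling x J J≤x)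
  where
  J = m ∸ suc x
  m≡y+J : m ≡ suc x + J
  m≡y+J = sym (m+[n∸m]≡n (<⇒≤ x<m))
  J≤x : J ≤ x
  J≤x = ≤-pred (+-cancelˡ-< (suc x) J (suc x) (subst₂ _<_ m≡y+J (2*n≡n+n (suc x)) m<2y))

prevEdgeColour-rising : ∀ {m x} → 1 + 2 * x < m → rimEdgeColour m (prev m (suc x)) ≡ 1 + (2 + 2 * suc x)
prevEdgeColour-rising {m} {x} lt = trans (rimEdgeColour-rising {m} {x} lt) (cong (3 +_) (sym (2*[1+n]≡2+2*n x)))

rimSpectrum : ∀ {m x} → Position m x → RimSpectrum m x
rimSpectrum (first {suc m} (s≤s 1≤m)) = record
  { base = 2 ; arrangement = ⟨132⟩
  ; spoke≡ = spokeColour-rising {suc m} {0} z<s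
  ; vertex≡ = refl
  ; next≡ = rimEdgeColour-rising {suc m} {0} (s≤s 1≤m)
  ; prev≡ = rimEdgeColour-wrap m
  }
rimSpectrum {m} (rising x lt) = record
  { base = 2 + 2 * suc x ; arrangement = ⟨231⟩
  ; spoke≡ = spoke≡
  ; vertex≡ = rimVertexColour-below {m} {x} spoke≡ (λ e → <-irrefl (suc-injective e) lt)
  ; next≡ = rimEdgeColour-rising {m} {suc x} lt
  ; prev≡ = prevEdgeColour-rising {m} {x} (<-trans (s<s (*-monoʳ-< 2 (n<1+n x))) lt)
  }
  where
  spoke≡ : spokeColour m (suc x) ≡ 2 + 2 * suc x
  spoke≡ = spokeColour-rising {m} {suc x} (<-trans (n<1+n _) lt)
rimSpectrum (peakOdd x) = record
  { base = 2 + 2 * suc x ; arrangement = ⟨321⟩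
  ; spoke≡ = spoke≡
  ; vertex≡ = rimVertexColour-top {m} {x} spoke≡ refl
  ; next≡ = trans (rimEdgeColour-falling {m} {suc x} {2 + x} (1+2*n≡n+[1+n] (suc x)) ≤-refl)
                  (cong (2 +_) (2*[1+n]≡2+2*n (suc x)))
  ; prev≡ = prevEdgeColour-rising {m} {x} (s<s (*-monoʳ-< 2 (n<1+n x)))
  }
  where
  m = 1 + 2 * suc x
  spoke≡ : spokeColour m (suc x) ≡ 2 + 2 * suc x
  spoke≡ = spokeColour-rising {m} {suc x} (n<1+n _)
rimSpectrum (peakEven x) = record
  { base = 1 + 2 * suc x ; arrangement = ⟨312⟩
  ; spoke≡ = spoke≡
  ; vertex≡ = rimVertexColour-top {m} {x} spoke≡ refl
  ; next≡ = rimEdgeColour-falling {m} {suc x} {suc x} (2*n≡n+n (suc x)) (n≤1+n _)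
  ; prev≡ = prevEdgeColour-rising {m} {x} (≤-reflexive (sym (2*[1+n]≡2+2*n x)))
  }
  where
  m = 2 * suc x
  spoke≡ : spokeColour m (suc x) ≡ 1 + 2 * suc x
  spoke≡ = spokeColour-falling {m} {suc x} {suc x} (2*n≡n+n (suc x)) ≤-refl
rimSpectrum (falling x J J≤x) = record
  { base = 1 + 2 * J ; arrangement = ⟨213⟩
  ; spoke≡ = spoke≡
  ; vertex≡ = rimVertexColour-below {m} {x} spoke≡ 1+2J≢1+m
  ; next≡ = rimEdgeColour-falling {m} {suc x} {J} refl (≤-trans m≤2y (n≤1+n _))
  ; prev≡ = trans (rimEdgeColour-falling {m} {x} {suc J} (sym (+-suc x J)) m≤1+2x)
                  (cong (2 +_) (2*[1+n]≡2+2*n J))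
  }
  where
  m = suc x + J
  m≤2y : m ≤ 2 * suc x
  m≤2y = m≡n+o⇒o≤n⇒m≤2*n {m} {suc x} {J} refl (m≤n⇒m≤1+n J≤x)
  m≤1+2x : m ≤ 1 + 2 * x
  m≤1+2x = s≤s (subst (x + J ≤_) (sym (2*n≡n+n x)) (+-monoʳ-≤ x J≤x))
  spoke≡ : spokeColour m (suc x) ≡ 1 + 2 * J
  spoke≡ = spokeColour-falling {m} {suc x} {J} refl m≤2y
  1+2J≢1+m : 1 + 2 * J ≢ suc m
  1+2J≢1+m e = 1+n≰n (≤-trans (≤-reflexive (sym J≡1+x)) J≤x)
    where
    J≡1+x : J ≡ suc x
    J≡1+x = +-cancelʳ-≡ J J (suc x) (trans (sym (2*n≡n+n J)) (suc-injective e))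

module WheelColouring (k : ℕ) where

  m : ℕ
  m = 3 + k

  3≤m : 3 ≤ m
  3≤m = s≤s (s≤s (s≤s z≤n))

  G : Graph
  G = Wheel (suc m) (s≤s 3≤m)

  vertexColour : Fin (suc m) → ℕ
  vertexColour zero    = 1
  vertexColour (suc i) = rimVertexColour m (toℕ i)

  edgeColour : Fin (suc m) → Fin (suc m) → ℕ
  edgeColour zero    zero    = 0
  edgeColour zero    (suc j) = spokeColour m (toℕ j)
  edgeColour (suc i) zero    = spokeColour m (toℕ i)
  edgeColour (suc i) (suc j) = rimEdgeColour m (edgeStart m (toℕ i) (toℕ j))

  edgeColour-sym : ∀ v w → Adj G v w → edgeColour v w ≡ edgeColour w v
  edgeColour-sym zero    zero    _ = refl
  edgeColour-sym zero    (suc j) _ = refl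
  edgeColour-sym (suc i) zero    _ = refl
  edgeColour-sym (suc i) (suc j) _ = cong (rimEdgeColour m) (edgeStart-comm m (toℕ i) (toℕ j))

  α : TotalAssignment G
  α = record { vcol = vertexColour ; ecol = edgeColour ; ecol-sym = edgeColour-sym }

  spectrum⇒used : ∀ {v c} → InSpectrum G α v c → ColourUsed G α c
  spectrum⇒used {v} (inj₁ e)             = inj₁ (v , e)
  spectrum⇒used {v} (inj₂ (w , vw , e)) = inj₂ (v , w , vw , e)

  Adj-irrefl : ∀ v → ¬ Adj G v v
  Adj-irrefl v t = subst T (irrefl G v) t

  degree-hub : degree G zero ≡ m
  degree-hub = trans
    (length-filterᵇ-tabulate (suc m) id (adj G zero) (λ { zero → false ; (suc _) → true })
      (λ { zero → refl ; (suc _) → refl }))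
    (count-true m)

  nextᶠ prevᶠ : Fin m → Fin m
  nextᶠ i = fromℕ< (next<m (toℕ<n i))
  prevᶠ i = fromℕ< (prev<m (toℕ<n i))

  data Incidence (i : Fin m) : Fin (suc m) → Set where
    toHub  : Incidence i zero
    toNext : Incidence i (suc (nextᶠ i))
    toPrev : Incidence i (suc (prevᶠ i))

  incidence : ∀ i w → Adj G (suc i) w → Incidence i w
  incidence i zero    _ = toHub
  incidence i (suc j) t with rimAdjℕ⇒ (toℕ<n j) t
  ... | inj₁ e = subst (Incidence i ∘ suc) (sym (toℕ-injective (trans e (sym (toℕ-fromℕ< _))))) toNext
  ... | inj₂ e = subst (Incidence i ∘ suc) (sym (toℕ-injective (trans e (sym (toℕ-fromℕ< _))))) toPrev

  incidence-adj : ∀ {i w} → Incidence i w → Adj G (suc i) w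
  incidence-adj         toHub  = tt
  incidence-adj {i} toNext =
    subst (T ∘ rimAdjℕ m (toℕ i)) (sym (toℕ-fromℕ< (next<m (toℕ<n i)))) (rimAdjℕ-next {m} (toℕ<n i))
  incidence-adj {i} toPrev =
    subst (T ∘ rimAdjℕ m (toℕ i)) (sym (toℕ-fromℕ< (prev<m (toℕ<n i)))) (rimAdjℕ-prev {m} (toℕ i))

  degree-rim : ∀ i → degree G (suc i) ≡ 3
  degree-rim i = trans
    (length-filterᵇ-tabulate (suc m) id (adj G (suc i))
      (λ { zero → true ; (suc y) → rimAdjℕ m x y }) (λ { zero → refl ; (suc _) → refl }))
    (cong suc (count-pair (rimAdjℕ m x) (next<m x<m) (prev<m x<m) (next≢prev 3≤m x<m) neighbours))
    where
    x = toℕ i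
    x<m = toℕ<n i
    neighbours : ∀ y → y < m → T (rimAdjℕ m x y) ⇔ (y ≡ next m x ⊎ y ≡ prev m x)
    neighbours y y<m = mk⇔ (rimAdjℕ⇒ y<m)
      λ { (inj₁ refl) → rimAdjℕ-next x<m ; (inj₂ refl) → rimAdjℕ-prev x }

  hubEdge-range : ∀ j → 2 ≤ edgeColour zero (suc j) × edgeColour zero (suc j) ≤ suc m
  hubEdge-range j = spokeColour-bounds (toℕ<n j)

  module Rim (i : Fin m) where
    open RimSpectrum (rimSpectrum (position (s≤s (s≤s z≤n)) (toℕ<n i))) public

    x : ℕ
    x = toℕ i

    offset : ∀ {w} → Incidence i w → ℕ
    offset toHub  = 0
    offset toNext = q
    offset toPrev = r

    edgeColour≡ : ∀ {w} (c : Incidence i w) → edgeColour (suc i) w ≡ offset c + base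
    edgeColour≡ toHub  = spoke≡
    edgeColour≡ toNext = begin
      rimEdgeColour m (edgeStart m x (toℕ (nextᶠ i))) ≡⟨ cong (rimEdgeColour m ∘ edgeStart m x) (toℕ-fromℕ< _) ⟩
      rimEdgeColour m (edgeStart m x (next m x))      ≡⟨ cong (rimEdgeColour m) (edgeStart-next 3≤m (toℕ<n i)) ⟩
      rimEdgeColour m x                               ≡⟨ next≡ ⟩
      q + base                                        ∎
      where open ≡-Reasoning
    edgeColour≡ toPrev = begin
      rimEdgeColour m (edgeStart m x (toℕ (prevᶠ i))) ≡⟨ cong (rimEdgeColour m ∘ edgeStart m x) (toℕ-fromℕ< _) ⟩
      rimEdgeColour m (edgeStart m x (prev m x))      ≡⟨ cong (rimEdgeColour m) (edgeStart-prev {m} {x} 3≤m) ⟩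
      rimEdgeColour m (prev m x)                      ≡⟨ prev≡ ⟩
      r + base                                        ∎
      where open ≡-Reasoning

    offset≤3 : ∀ {w} (c : Incidence i w) → offset c ≤ 3
    offset≤3 toHub  = z≤n
    offset≤3 toNext = proj₁ (proj₂ (arrangement-≤3 arrangement))
    offset≤3 toPrev = proj₂ (proj₂ (arrangement-≤3 arrangement))

    offset-injective : ∀ {w w′} (c : Incidence i w) (c′ : Incidence i w′) →
      offset c ≡ offset c′ → w ≡ w′
    offset-injective toHub  toHub  _ = refl
    offset-injective toNext toNext _ = refl
    offset-injective toPrev toPrev _ = refl
    offset-injective toHub  toNext e = ⊥-elim (proj₁ (proj₂ (arrangement-≢0 arrangement)) (sym e))
    offset-injective toHub  toPrev e = ⊥-elim (proj₂ (proj₂ (arrangement-≢0 arrangement)) (sym e))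
    offset-injective toNext toHub  e = ⊥-elim (proj₁ (proj₂ (arrangement-≢0 arrangement)) e)
    offset-injective toPrev toHub  e = ⊥-elim (proj₂ (proj₂ (arrangement-≢0 arrangement)) e)
    offset-injective toNext toPrev e = ⊥-elim (proj₂ (proj₂ (arrangement-≢ arrangement)) e)
    offset-injective toPrev toNext e = ⊥-elim (proj₂ (proj₂ (arrangement-≢ arrangement)) (sym e))

    p≢offset : ∀ {w} (c : Incidence i w) → p ≢ offset c
    p≢offset toHub  = proj₁ (arrangement-≢0 arrangement)
    p≢offset toNext = proj₁ (arrangement-≢ arrangement)
    p≢offset toPrev = proj₁ (proj₂ (arrangement-≢ arrangement))

    base-range : 2 ≤ base × base ≤ suc m
    base-range = subst (λ b → 2 ≤ b × b ≤ suc m) spoke≡ (spokeColour-bounds (toℕ<n i))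

    incident : ∀ {w} (c : Incidence i w) → InSpectrum G α (suc i) (offset c + base)
    incident {w} c = inj₂ (w , incidence-adj c , edgeColour≡ c)

    interval : ∀ c → (base ≤ c × c ≤ base + 3) ⇔ InSpectrum G α (suc i) c
    interval c = mk⇔ to from
      where
      shifted : ∀ {d} → d ≤ 3 → base ≤ d + base × d + base ≤ base + 3
      shifted {d} d≤3 = m≤n+m base d , subst (d + base ≤_) (+-comm 3 base) (+-monoˡ-≤ base d≤3)
      move : ∀ {d o} → d ≡ o → InSpectrum G α (suc i) (o + base) → InSpectrum G α (suc i) (d + base)
      move d≡o = subst (λ o → InSpectrum G α (suc i) (o + base)) (sym d≡o)
      at : ∀ d → d ≤ 3 → InSpectrum G α (suc i) (d + base)
      at zero _ = incident toHub
      at (suc d) d≤3 with arrangement-covers arrangement (suc d) (s≤s z≤n) d≤3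
      ... | inj₁ d≡p        = move d≡p (inj₁ vertex≡)
      ... | inj₂ (inj₁ d≡q) = move d≡q (incident toNext)
      ... | inj₂ (inj₂ d≡r) = move d≡r (incident toPrev)
      to : base ≤ c × c ≤ base + 3 → InSpectrum G α (suc i) c
      to (base≤c , c≤base+3) = subst (InSpectrum G α (suc i)) (m∸n+n≡m base≤c)
        (at (c ∸ base) (subst (c ∸ base ≤_) (m+n∸m≡n base 3) (∸-monoˡ-≤ base c≤base+3)))
      from : InSpectrum G α (suc i) c → base ≤ c × c ≤ base + 3
      from (inj₁ refl) =
        subst (λ v → base ≤ v × v ≤ base + 3) (sym vertex≡) (shifted (proj₁ (arrangement-≤3 arrangement)))
      from (inj₂ (w , t , refl)) =
        subst (λ v → base ≤ v × v ≤ base + 3) (sym (edgeColour≡ c′)) (shifted (offset≤3 c′))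
        where c′ = incidence i w t

  vertexColour≥2 : ∀ i → 2 ≤ vertexColour (suc i)
  vertexColour≥2 i = subst (2 ≤_) (sym vertex≡) (≤-trans (proj₁ base-range) (m≤n+m base p))
    where open Rim i

  vertices-distinct : ∀ v w → Adj G v w → vertexColour v ≢ vertexColour w
  vertices-distinct zero    (suc j) _ e = <⇒≢ (vertexColour≥2 j) e
  vertices-distinct (suc i) zero    _ e = <⇒≢ (vertexColour≥2 i) (sym e)
  vertices-distinct (suc i) (suc j) t e =
    Adj-irrefl (suc i) (subst (Adj G (suc i)) (sym (cong suc (toℕ-injective i≡j))) t)
    where i≡j = rimVertexColour-injective (toℕ<n i) (toℕ<n j) e

  edges-distinct : ∀ v w w′ → Adj G v w → Adj G v w′ → w ≢ w′ → edgeColour v w ≢ edgeColour v w′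
  edges-distinct zero (suc j) (suc j′) _ _ j≢j′ e =
    j≢j′ (cong suc (toℕ-injective (spokeColour-injective (toℕ<n j) (toℕ<n j′) e)))
  edges-distinct (suc i) w w′ t t′ w≢w′ e =
    w≢w′ (offset-injective c c′ (+-cancelʳ-≡ base (offset c) (offset c′)
      (trans (sym (edgeColour≡ c)) (trans e (edgeColour≡ c′)))))
    where
    open Rim i
    c = incidence i w t
    c′ = incidence i w′ t′

  vertex-edge-distinct : ∀ v w → Adj G v w → vertexColour v ≢ edgeColour v w
  vertex-edge-distinct zero    (suc j) _ e = <⇒≢ (proj₁ (hubEdge-range j)) e
  vertex-edge-distinct (suc i) w       t e =
    p≢offset c (+-cancelʳ-≡ base p (offset c) (trans (sym vertex≡) (trans e (edgeColour≡ c))))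
    where
    open Rim i
    c = incidence i w t

  in-range : ∀ {d b} → 2 ≤ b → b ≤ suc m → d ≤ 3 → 1 ≤ d + b × d + b ≤ suc m + 3
  in-range {d} {b} 2≤b b≤1+m d≤3 =
    ≤-trans (n≤1+n 1) (≤-trans 2≤b (m≤n+m b d)) ,
    subst (d + b ≤_) (+-comm 3 (suc m)) (+-mono-≤ d≤3 b≤1+m)

  vertexColour-range : ∀ v → 1 ≤ vertexColour v × vertexColour v ≤ suc m + 3
  vertexColour-range zero    = s≤s z≤n , s≤s z≤n
  vertexColour-range (suc i) = subst (λ v → 1 ≤ v × v ≤ suc m + 3) (sym vertex≡)
      (in-range (proj₁ base-range) (proj₂ base-range) (proj₁ (arrangement-≤3 arrangement)))
    where open Rim i

  edgeColour-range : ∀ v w → Adj G v w → 1 ≤ edgeColour v w × edgeColour v w ≤ suc m + 3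
  edgeColour-range zero (suc j) _ = in-range {0} (proj₁ (hubEdge-range j)) (proj₂ (hubEdge-range j)) z≤n
  edgeColour-range (suc i) w t = subst (λ v → 1 ≤ v × v ≤ suc m + 3) (sym (edgeColour≡ c))
      (in-range (proj₁ base-range) (proj₂ base-range) (offset≤3 c))
    where
    open Rim i
    c = incidence i w t

  hub-interval : ∀ c → (1 ≤ c × c ≤ 1 + degree G zero) ⇔ InSpectrum G α zero c
  hub-interval c rewrite degree-hub = mk⇔ to from
    where
    to : 1 ≤ c × c ≤ 1 + m → InSpectrum G α zero c
    to (1≤c , c≤1+m) with m≤n⇒m<n∨m≡n 1≤c
    ... | inj₂ refl = inj₁ refl
    ... | inj₁ 2≤c with spokeColour-surjective {m} 2≤c c≤1+m
    ...   | x , x<m , e = inj₂ (suc (fromℕ< x<m) , tt , trans (cong (spokeColour m) (toℕ-fromℕ< x<m)) e)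
    from : InSpectrum G α zero c → 1 ≤ c × c ≤ 1 + m
    from (inj₁ refl) = s≤s z≤n , s≤s z≤n
    from (inj₂ (suc j , _ , refl)) = ≤-trans (n≤1+n 1) (proj₁ (hubEdge-range j)) , proj₂ (hubEdge-range j)

  rim-interval : ∀ i c → (Rim.base i ≤ c × c ≤ Rim.base i + degree G (suc i)) ⇔ InSpectrum G α (suc i) c
  rim-interval i c rewrite degree-rim i = Rim.interval i c

  colour-used : ∀ c → 1 ≤ c → c ≤ suc m + 3 → ColourUsed G α c
  colour-used c 1≤c c≤t with c ≤? suc m
  ... | yes c≤1+m = spectrum⇒used {zero}
    (Equivalence.to (hub-interval c) (1≤c , subst (c ≤_) (cong suc (sym degree-hub)) c≤1+m))
  ... | no  c≰1+m with spokeColour-surjective {m} {suc m} (s≤s (s≤s z≤n)) ≤-refl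
  ...   | x , x<m , spoke≡1+m =
    spectrum⇒used {suc iₜ} (Equivalence.to (Rim.interval iₜ c) (base≤c , c≤base+3))
    where
    iₜ = fromℕ< x<m
    base≡ : Rim.base iₜ ≡ suc m
    base≡ = trans (sym (Rim.spoke≡ iₜ)) (trans (cong (spokeColour m) (toℕ-fromℕ< x<m)) spoke≡1+m)
    base≤c : Rim.base iₜ ≤ c
    base≤c = subst (_≤ c) (sym base≡) (<⇒≤ (≰⇒> c≰1+m))
    c≤base+3 : c ≤ Rim.base iₜ + 3
    c≤base+3 = subst (λ b → c ≤ b + 3) (sym base≡) c≤t

  coloring : HasIntervalTotalColoring G (suc m + 3)
  coloring = α ,
    ( (vertices-distinct , edges-distinct , vertex-edge-distinct)
    , vertexColour-range
    , edgeColour-range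
    , colour-used
    , λ { zero → 1 , hub-interval ; (suc i) → Rim.base i , rim-interval i } )

lemma3 : (n : ℕ) → (h : 4 ≤ n) → HasIntervalTotalColoring (Wheel n h) (n + 3)
lemma3 (suc (suc (suc (suc k)))) (s≤s (s≤s (s≤s (s≤s z≤n)))) = WheelColouring.coloring k
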